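{- In PAP with pattern length $k=4$ started from $S_n$, the move-by-move reverse strategy is a winning strategy for Player II when $n=4$, and it is not a winning strategy for Player II when $n\in\{5,6,7,8,9\}$.
   Context: $S_n$ is the set of permutations of $\{1,\dots,n\}$ in one-line notation; $\pi^r$ denotes the reverse of $\pi$. PAP with pattern length $k$: a position is a subset $X\subseteq S_n$; a move chooses a pattern $p\in S_k$ contained (classically) in at least one permutation of $X$ and replaces $X$ by the permutations of $X$ avoiding $p$; normal play (a player with no legal move loses); Player I moves first from $X=S_n$. The move-by-move reverse strategy for Player II: whenever Player I chooses $p$, Player II replies with $p^r$. It is a winning strategy if, against every sequence of legal moves of Player I, each reply $p^r$ is legal and the game ends with Player II having made the last move. -}

module Defs where

open import Data.Nat using (ℕ; suc; _<_)
open import Data.List using (List; map; upTo; reverse; length; lookup)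
open import Data.List.Relation.Binary.Permutation.Propositional using (_↭_)
open import Data.List.Relation.Binary.Sublist.Propositional using (_⊆_)
open import Data.Fin using (Fin; cast)
open import Data.Product using (Σ; ∃; _×_)
open import Relation.Binary.PropositionalEquality using (_≡_)
open import Relation.Nullary using (¬_)
open import Function.Bundles using (_⇔_)
open import Level using () renaming (suc to lsuc; zero to lzero)

-- A permutation of {1,…,n} in one-line notation: a list that is a
-- rearrangement of [1,2,…,n].  S n = { π | IsPerm n π }.
IsPerm : ℕ → List ℕ → Set
IsPerm n π = π ↭ map suc (upTo n)

OrderIso : List ℕ → List ℕ → Set
OrderIso σ p =
  Σ (length σ ≡ length p) λ eq →
    ∀ (i j : Fin (length σ)) →
      (lookup σ i < lookup σ j) ⇔ (lookup p (cast eq i) < lookup p (cast eq j))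

Contains : List ℕ → List ℕ → Set
Contains π p = ∃ λ σ → (σ ⊆ π) × OrderIso σ p

-- Positions are subsets of S_n, given as predicates on one-line lists.
Position : Set₁
Position = List ℕ → Set

Legal : ℕ → Position → List ℕ → Set
Legal k X p = IsPerm k p × (∃ λ π → X π × Contains π p)

after : Position → List ℕ → Position
after X p π = X π × ¬ Contains π p

-- From position X with Player I to move, the move-by-move reverse strategy
-- wins for Player II: for every legal move p of Player I, the reply pʳ is
-- legal and the strategy wins again from the resulting position.
-- (Inductive, so every play against it is finite; when Player I has no legal
-- move, Player I loses and Player II made the last move.)
data ReverseWins (k : ℕ) : Position → Set₁ where
  wins : ∀ {X} →
    (∀ p → Legal k X p →
      Legal k (after X p) (reverse p) × ReverseWins k (after (after X p) (reverse p))) →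
    ReverseWins k X

ReverseStrategyWinning : (k n : ℕ) → Set₁
ReverseStrategyWinning k n = ReverseWins k (IsPerm n)

{-# OPTIONS --safe #-}
-- For k = n = 4 a permutation in S₄ contains no pattern of S₄ other than itself
-- and differs from its reverse.  So if Player I plays p in a reverse-closed
-- position, p itself is in the position, pʳ survives the move and is a legal
-- reply, and the round deletes exactly {p, pʳ}: the position stays
-- reverse-closed and shrinks, and Player II always has the last word.
-- For 5 ≤ n ≤ 9 Player I has explicit plays after which the reverse of Player
-- I's last move occurs in no remaining permutation; this is checked by listing
-- the permutations that avoid every pattern played so far (for n ≥ 6 none are left).
module Submission where

open import Defs
open import Data.Nat using (ℕ; zero; suc; _<_; _≤_; _≟_; s≤s)
open import Data.Nat.Induction using (<-wellFounded)
open import Data.Nat.Properties using (_<?_)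
open import Data.List using (List; []; _∷_; [_]; _++_; map; upTo; reverse; length; lookup; concatMap; filter)
open import Data.List.Properties using (map-++; upTo-∷ʳ; ++-identityʳ; reverse-involutive; reverse-injective; filter-notAll)
  renaming (≡-dec to ≡-dec-List)
open import Data.List.Membership.Propositional using (_∈_; find; lose)
open import Data.List.Membership.Propositional.Properties using (∈-++⁺ˡ; ∈-++⁺ʳ; ∈-++⁻; ∈-map⁺; ∈-map⁻; ∈-∃++; ∈-concatMap⁺; ∈-filter⁺)
open import Data.List.Relation.Binary.Permutation.Propositional using (_↭_; ↭-refl; ↭-sym; ↭-trans; prep)
open import Data.List.Relation.Binary.Permutation.Propositional.Properties using (∈-resp-↭; ↭-length; ↭-empty-inv; shift; drop-∷; drop-mid; ↭-reverse)
open import Data.List.Relation.Binary.Sublist.Propositional using (_⊆_; []; _∷ʳ_; _∷_; ⊆-refl; ⊆-trans)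
open import Data.List.Relation.Binary.Sublist.Propositional.Properties using (++⁺)
open import Data.List.Relation.Unary.All as All using (All; []; _∷_)
open import Data.List.Relation.Unary.Any as Any using (Any; here; there; any?)
open import Data.Fin using (cast)
open import Data.Fin.Properties using (all?; cast-is-id)
open import Data.Product using (_×_; _,_; proj₁; proj₂; uncurry)
open import Data.Sum using (inj₁; inj₂)
open import Function using (_∘_; id; _$_)
open import Function.Bundles using (_⇔_; mk⇔; Equivalence)
open import Function.Construct.Identity using (⇔-id)
open import Induction.WellFounded using (Acc; acc)
open import Relation.Binary.Definitions using (DecidableEquality)
open import Relation.Binary.PropositionalEquality using (_≡_; _≢_; refl; sym; trans; cong; subst; subst₂)
open import Relation.Nullary using (¬_; Dec; yes; no; ¬?; contradiction)
open import Relation.Nullary.Decidable using (True; toWitness; from-yes; map′; _×-dec_; _→-dec_)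

_⇔-dec_ : ∀ {a b} {A : Set a} {B : Set b} → Dec A → Dec B → Dec (A ⇔ B)
a? ⇔-dec b? = map′ (uncurry mk⇔) (λ e → Equivalence.to e , Equivalence.from e) ((a? →-dec b?) ×-dec (b? →-dec a?))

_≡?_ : DecidableEquality (List ℕ)
_≡?_ = ≡-dec-List _≟_

module _ {a} {A : Set a} where

  ↭-dec : DecidableEquality A → (xs ys : List A) → Dec (xs ↭ ys)
  ↭-dec _≟ₐ_ []       []      = yes ↭-refl
  ↭-dec _≟ₐ_ []       (_ ∷ _) = no λ p → contradiction (↭-length p) λ ()
  ↭-dec _≟ₐ_ (x ∷ xs) ys with any? (x ≟ₐ_) ys
  ... | no  x∉ys = no λ p → x∉ys (∈-resp-↭ p (here refl))
  ... | yes x∈ys with as , bs , refl ← ∈-∃++ x∈ys =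
    map′ (λ q → ↭-trans (prep x q) (↭-sym (shift x as bs)))
         (λ p → drop-∷ (↭-trans p (shift x as bs)))
         (↭-dec _≟ₐ_ xs (as ++ bs))

  sublists : ℕ → List A → List (List A)
  sublists zero    _        = [ [] ]
  sublists (suc k) []       = []
  sublists (suc k) (x ∷ xs) = map (x ∷_) (sublists k xs) ++ sublists (suc k) xs

  sublists-complete : ∀ {σ π : List A} → σ ⊆ π → σ ∈ sublists (length σ) π
  sublists-complete []                 = here refl
  sublists-complete {[]}    (_ ∷ʳ _)   = here refl
  sublists-complete {_ ∷ _} (_ ∷ʳ σ⊆π) = ∈-++⁺ʳ _ (sublists-complete σ⊆π)
  sublists-complete (refl ∷ σ⊆π)       = ∈-++⁺ˡ (∈-map⁺ _ (sublists-complete σ⊆π))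

  sublists-sound : ∀ k {σ} (π : List A) → σ ∈ sublists k π → σ ⊆ π
  sublists-sound zero    []      (here refl) = []
  sublists-sound zero    (x ∷ π) (here refl) = x ∷ʳ sublists-sound zero π (here refl)
  sublists-sound (suc k) (x ∷ π) σ∈ with ∈-++⁻ (map (x ∷_) (sublists k π)) σ∈
  ... | inj₂ σ∈′ = x ∷ʳ sublists-sound (suc k) π σ∈′
  ... | inj₁ σ∈′ with τ , τ∈ , refl ← ∈-map⁻ (x ∷_) σ∈′ = refl ∷ sublists-sound k π τ∈

  insertions : A → List A → List (List A)
  insertions x []       = [ [ x ] ]
  insertions x (y ∷ ys) = (x ∷ y ∷ ys) ∷ map (y ∷_) (insertions x ys)

  ∈-insertions : ∀ x (xs ys : List A) → xs ++ x ∷ ys ∈ insertions x (xs ++ ys)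
  ∈-insertions x []       []      = here refl
  ∈-insertions x []       (_ ∷ _) = here refl
  ∈-insertions x (z ∷ xs) ys      = there (∈-map⁺ (z ∷_) (∈-insertions x xs ys))

IsPerm? : ∀ n π → Dec (IsPerm n π)
IsPerm? n π = ↭-dec _≟_ π (map suc (upTo n))

IsPerm-reverse : ∀ {n π} → IsPerm n π → IsPerm n (reverse π)
IsPerm-reverse {π = π} = ↭-trans (↭-reverse π)

map-suc-upTo-suc : ∀ n → map suc (upTo (suc n)) ≡ map suc (upTo n) ++ [ suc n ]
map-suc-upTo-suc n = trans (cong (map suc) (sym (upTo-∷ʳ n))) (map-++ suc (upTo n) [ n ])

max∈IsPerm : ∀ {n π} → IsPerm (suc n) π → suc n ∈ π
max∈IsPerm {n} h = ∈-resp-↭ (↭-sym h) (subst (suc n ∈_) (sym (map-suc-upTo-suc n)) (∈-++⁺ʳ _ (here refl)))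

IsPerm-delete-max : ∀ {n} xs ys → IsPerm (suc n) (xs ++ suc n ∷ ys) → IsPerm n (xs ++ ys)
IsPerm-delete-max {n} xs ys h = subst (xs ++ ys ↭_) (++-identityʳ _)
  (drop-mid xs (map suc (upTo n)) (subst (xs ++ suc n ∷ ys ↭_) (map-suc-upTo-suc n) h))

-- `cast` ignores its (irrelevant) equation, so the decision made with |σ|≡|p|
-- covers every proof of OrderIso σ p.
OrderIso? : (σ p : List ℕ) → Dec (OrderIso σ p)
OrderIso? σ p with length σ ≟ length p
... | no  |σ|≢|p| = no (|σ|≢|p| ∘ proj₁)
... | yes |σ|≡|p| = map′ (|σ|≡|p| ,_) (λ o i j → proj₂ o i j)
  (all? λ i → all? λ j →
    (lookup σ i <? lookup σ j) ⇔-dec (lookup p (cast |σ|≡|p| i) <? lookup p (cast |σ|≡|p| j)))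

OrderIso-refl : ∀ σ → OrderIso σ σ
OrderIso-refl σ = refl , λ i j →
  subst₂ (λ i′ j′ → (lookup σ i < lookup σ j) ⇔ (lookup σ i′ < lookup σ j′))
         (sym (cast-is-id refl i)) (sym (cast-is-id refl j)) (⇔-id _)

Contains? : (π p : List ℕ) → Dec (Contains π p)
Contains? π p = map′ found candidate (any? (λ σ → OrderIso? σ p) (sublists (length p) π))
  where
  found : Any (λ σ → OrderIso σ p) (sublists (length p) π) → Contains π p
  found any with σ , σ∈ , σ≅p ← find any = σ , sublists-sound (length p) π σ∈ , σ≅p
  candidate : Contains π p → Any (λ σ → OrderIso σ p) (sublists (length p) π)
  candidate (σ , σ⊆π , σ≅p) =
    lose (subst (λ k → σ ∈ sublists k π) (proj₁ σ≅p) (sublists-complete σ⊆π)) σ≅p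

Contains-refl : ∀ π → Contains π π
Contains-refl π = π , ⊆-refl , OrderIso-refl π

Contains-⊆ : ∀ {τ π p} → τ ⊆ π → Contains τ p → Contains π p
Contains-⊆ τ⊆π (σ , σ⊆τ , σ≅p) = σ , ⊆-trans σ⊆τ τ⊆π , σ≅p

avoids⇒≢ : ∀ {π p} → ¬ Contains π p → π ≢ p
avoids⇒≢ {π} π⊉p refl = π⊉p (Contains-refl π)

Avoids : List (List ℕ) → List ℕ → Set
Avoids F π = All (¬_ ∘ Contains π) F

avoids? : ∀ F π → Dec (Avoids F π)
avoids? F π = All.all? (¬? ∘ Contains? π) F

Avoids-⊆ : ∀ {F τ π} → τ ⊆ π → Avoids F π → Avoids F τ
Avoids-⊆ τ⊆π = All.map λ {p} π⊉p → π⊉p ∘ Contains-⊆ {p = p} τ⊆π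

-- Deleting the largest entry preserves avoidance, so every permutation of
-- length n + 1 avoiding F arises by inserting n + 1 into a member of Av F n.
Av : List (List ℕ) → ℕ → List (List ℕ)
Av F zero    = [ [] ]
Av F (suc n) = filter (avoids? F) (concatMap (insertions (suc n)) (Av F n))

Av-complete : ∀ F n {π} → IsPerm n π → Avoids F π → π ∈ Av F n
Av-complete F zero    h _ with refl ← ↭-empty-inv h = here refl
Av-complete F (suc n) h π⊉F with xs , ys , refl ← ∈-∃++ (max∈IsPerm h) =
  ∈-filter⁺ (avoids? F) (∈-concatMap⁺ (insertions (suc n)) (lose rest∈ (∈-insertions (suc n) xs ys))) π⊉F
  where
  rest∈ : xs ++ ys ∈ Av F n
  rest∈ = Av-complete F n (IsPerm-delete-max xs ys h) (Avoids-⊆ (++⁺ ⊆-refl (suc n ∷ʳ ⊆-refl)) π⊉F)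

S : ℕ → List (List ℕ)
S = Av []

IsPerm⇒∈S : ∀ {n π} → IsPerm n π → π ∈ S n
IsPerm⇒∈S h = Av-complete [] _ h []

All-S⇒∀ : ∀ {n} {P : List ℕ → Set} → All P (S n) → ∀ {π} → IsPerm n π → P π
All-S⇒∀ P-all = All.lookup P-all ∘ IsPerm⇒∈S

containment-in-S₄-is-equality : ∀ {π p} → IsPerm 4 π → IsPerm 4 p → Contains π p → π ≡ p
containment-in-S₄-is-equality hπ = All-S⇒∀ (All-S⇒∀ table hπ)
  where
  table : All (λ π → All (λ p → Contains π p → π ≡ p) (S 4)) (S 4)
  table = from-yes (All.all? (λ π → All.all? (λ p → Contains? π p →-dec π ≡? p) (S 4)) (S 4))

reverse-in-S₄-≢ : ∀ {p} → IsPerm 4 p → reverse p ≢ p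
reverse-in-S₄-≢ = All-S⇒∀ (from-yes (All.all? (λ p → ¬? (reverse p ≡? p)) (S 4)))

afterRound : Position → List ℕ → Position
afterRound X p = after (after X p) (reverse p)

_⊆S_ : Position → ℕ → Set
X ⊆S k = ∀ {π} → X π → IsPerm k π

ReverseClosed : Position → Set
ReverseClosed X = ∀ {π} → X π → X (reverse π)

module ReverseStrategyForRigidPatterns {k : ℕ}
  (contains⇒≡ : ∀ {π p} → IsPerm k π → IsPerm k p → Contains π p → π ≡ p)
  (reverse≢ : ∀ {p} → IsPerm k p → reverse p ≢ p)
  where

  ≢⇒avoids : ∀ {σ p} → IsPerm k σ → IsPerm k p → σ ≢ p → ¬ Contains σ p
  ≢⇒avoids hσ hp σ≢p = σ≢p ∘ contains⇒≡ hσ hp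

  legal⇒member : ∀ {X p} → X ⊆S k → Legal k X p → X p
  legal⇒member {X} X⊆S (hp , π , Xπ , π⊇p) = subst X (contains⇒≡ (X⊆S Xπ) hp π⊇p) Xπ

  reply-legal : ∀ {X p} → X ⊆S k → ReverseClosed X → Legal k X p → Legal k (after X p) (reverse p)
  reply-legal {p = p} X⊆S closed legal@(hp , _) =
      hrp
    , reverse p
    , (closed (legal⇒member X⊆S legal) , ≢⇒avoids hrp hp (reverse≢ hp))
    , Contains-refl (reverse p)
    where
    hrp : IsPerm k (reverse p)
    hrp = IsPerm-reverse hp

  afterRound-reverseClosed : ∀ {X p} → X ⊆S k → ReverseClosed X → IsPerm k p →
                             ReverseClosed (afterRound X p)
  afterRound-reverseClosed {p = p} X⊆S closed hp {σ} ((Xσ , σ⊉p) , σ⊉rp) =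
    (closed Xσ , ≢⇒avoids hrσ hp rσ≢p) , ≢⇒avoids hrσ (IsPerm-reverse hp) rσ≢rp
    where
    hrσ : IsPerm k (reverse σ)
    hrσ = IsPerm-reverse (X⊆S Xσ)
    rσ≢p : reverse σ ≢ p
    rσ≢p rσ≡p = avoids⇒≢ σ⊉rp (trans (sym (reverse-involutive σ)) (cong reverse rσ≡p))
    rσ≢rp : reverse σ ≢ reverse p
    rσ≢rp = avoids⇒≢ σ⊉p ∘ reverse-injective {x = σ} {y = p}

  -- The list R bounds the position; each round removes p from it.
  reverse-wins : ∀ {X} (R : List (List ℕ)) → Acc _<_ (length R) →
                 X ⊆S k → ReverseClosed X → (∀ {π} → X π → π ∈ R) → ReverseWins k X
  reverse-wins {X} R (acc smaller) X⊆S closed listed = wins λ p legal →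
      reply-legal X⊆S closed legal
    , reverse-wins {afterRound X p} (filter (≢? p) R) (smaller (shorter p legal))
        (X⊆S ∘ proj₁ ∘ proj₁) (afterRound-reverseClosed X⊆S closed (proj₁ legal))
        (λ ((Xσ , σ⊉p) , _) → ∈-filter⁺ (≢? p) (listed Xσ) (avoids⇒≢ σ⊉p))
    where
    ≢? : ∀ p σ → Dec (σ ≢ p)
    ≢? p σ = ¬? (σ ≡? p)
    shorter : ∀ p → Legal k X p → length (filter (≢? p) R) < length R
    shorter p legal = filter-notAll (≢? p) R
      (Any.map (λ p≡σ σ≢p → σ≢p (sym p≡σ)) (listed (legal⇒member X⊆S legal)))

reverse-strategy-wins-S₄ : ReverseStrategyWinning 4 4
reverse-strategy-wins-S₄ = reverse-wins (S 4) (<-wellFounded _) id IsPerm-reverse IsPerm⇒∈S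
  where open ReverseStrategyForRigidPatterns containment-in-S₄-is-equality reverse-in-S₄-≢

-- The patterns played so far are listed most recent first.
afterAll : Position → List (List ℕ) → Position
afterAll X []       = X
afterAll X (q ∷ qs) = after (afterAll X qs) q

afterAll⇔ : ∀ {X} qs {π} → afterAll X qs π ⇔ (X π × Avoids qs π)
afterAll⇔ []       = mk⇔ (_, []) proj₁
afterAll⇔ (q ∷ qs) = mk⇔
  (λ (Yπ , π⊉q) → let Xπ , π⊉qs = Equivalence.to (afterAll⇔ qs) Yπ in Xπ , π⊉q ∷ π⊉qs)
  (λ { (Xπ , π⊉q ∷ π⊉qs) → Equivalence.from (afterAll⇔ qs) (Xπ , π⊉qs) , π⊉q })

data ReverseLoses (k : ℕ) (X : Position) : List (List ℕ) → Set₁ where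
  reply-illegal : ∀ {qs} p → Legal k (afterAll X qs) p →
                  ¬ Legal k (afterAll X (p ∷ qs)) (reverse p) → ReverseLoses k X qs
  next-round    : ∀ {qs} p → Legal k (afterAll X qs) p →
                  ReverseLoses k X (reverse p ∷ p ∷ qs) → ReverseLoses k X qs

ReverseLoses⇒¬ReverseWins : ∀ {k X qs} → ReverseLoses k X qs → ¬ ReverseWins k (afterAll X qs)
ReverseLoses⇒¬ReverseWins (reply-illegal p legal illegal) (wins reply) = illegal (proj₁ (reply p legal))
ReverseLoses⇒¬ReverseWins (next-round p legal loses) (wins reply) =
  ReverseLoses⇒¬ReverseWins loses (proj₂ (reply p legal))

LegalWitness : ℕ → ℕ → List (List ℕ) → List ℕ → List ℕ → Set
LegalWitness k n qs p π = IsPerm k p × IsPerm n π × Avoids qs π × Contains π p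

legalWitness? : ∀ k n qs p π → Dec (LegalWitness k n qs p π)
legalWitness? k n qs p π = IsPerm? k p ×-dec IsPerm? n π ×-dec avoids? qs π ×-dec Contains? π p

legal-by : ∀ {k n qs p π} → LegalWitness k n qs p π → Legal k (afterAll (IsPerm n) qs) p
legal-by {qs = qs} {π = π} (p∈Sₖ , π∈Sₙ , π⊉qs , π⊇p) =
  p∈Sₖ , π , Equivalence.from (afterAll⇔ qs) (π∈Sₙ , π⊉qs) , π⊇p

illegal-by-enumeration : ∀ {k n F r} → All (λ π → ¬ Contains π r) (Av F n) →
                         ¬ Legal k (afterAll (IsPerm n) F) r
illegal-by-enumeration {n = n} {F} Av⊉r (_ , π , Yπ , π⊇r)
  with π∈Sₙ , π⊉F ← Equivalence.to (afterAll⇔ F) Yπ =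
  All.lookup Av⊉r (Av-complete F n π∈Sₙ π⊉F) π⊇r

-- Stated for a fixed qs, so that Agda never has to invert the reducible `afterAll`.
next-round-by : ∀ {k n qs} p π → {True (legalWitness? k n qs p π)} →
                ReverseLoses k (IsPerm n) (reverse p ∷ p ∷ qs) → ReverseLoses k (IsPerm n) qs
next-round-by p π {w} = next-round p (legal-by (toWitness w))

reply-illegal-by : ∀ {k n qs} p π → {True (legalWitness? k n qs p π)} →
                   {True (All.all? (λ σ → ¬? (Contains? σ (reverse p))) (Av (p ∷ qs) n))} →
                   ReverseLoses k (IsPerm n) qs
reply-illegal-by {n = n} {qs} p π {w} {Av⊉rp} =
  reply-illegal p (legal-by (toWitness w)) (illegal-by-enumeration {n = n} {F = p ∷ qs} (toWitness Av⊉rp))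

-- Each line: Player I's move, then a permutation still in play that contains it.
counterplay₅ : ReverseLoses 4 (IsPerm 5) []
counterplay₅ =
  next-round-by    (1 ∷ 3 ∷ 4 ∷ 2 ∷ []) (1 ∷ 2 ∷ 4 ∷ 5 ∷ 3 ∷ []) $
  next-round-by    (2 ∷ 3 ∷ 1 ∷ 4 ∷ []) (2 ∷ 3 ∷ 1 ∷ 4 ∷ 5 ∷ []) $
  next-round-by    (3 ∷ 2 ∷ 1 ∷ 4 ∷ []) (1 ∷ 4 ∷ 3 ∷ 2 ∷ 5 ∷ []) $
  reply-illegal-by (2 ∷ 4 ∷ 1 ∷ 3 ∷ []) (3 ∷ 1 ∷ 5 ∷ 2 ∷ 4 ∷ [])

counterplay₆ : ReverseLoses 4 (IsPerm 6) []
counterplay₆ =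
  next-round-by    (1 ∷ 2 ∷ 3 ∷ 4 ∷ []) (1 ∷ 2 ∷ 3 ∷ 4 ∷ 5 ∷ 6 ∷ []) $
  next-round-by    (1 ∷ 2 ∷ 4 ∷ 3 ∷ []) (1 ∷ 3 ∷ 2 ∷ 6 ∷ 5 ∷ 4 ∷ []) $
  next-round-by    (2 ∷ 1 ∷ 4 ∷ 3 ∷ []) (2 ∷ 1 ∷ 5 ∷ 4 ∷ 3 ∷ 6 ∷ []) $
  reply-illegal-by (2 ∷ 1 ∷ 3 ∷ 4 ∷ []) (2 ∷ 5 ∷ 4 ∷ 1 ∷ 3 ∷ 6 ∷ [])

counterplay₇ : ReverseLoses 4 (IsPerm 7) []
counterplay₇ =
  next-round-by    (1 ∷ 2 ∷ 3 ∷ 4 ∷ []) (1 ∷ 2 ∷ 3 ∷ 4 ∷ 5 ∷ 6 ∷ 7 ∷ []) $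
  next-round-by    (1 ∷ 2 ∷ 4 ∷ 3 ∷ []) (1 ∷ 4 ∷ 3 ∷ 2 ∷ 7 ∷ 6 ∷ 5 ∷ []) $
  next-round-by    (3 ∷ 2 ∷ 1 ∷ 4 ∷ []) (2 ∷ 6 ∷ 5 ∷ 1 ∷ 7 ∷ 3 ∷ 4 ∷ []) $
  reply-illegal-by (2 ∷ 1 ∷ 4 ∷ 3 ∷ []) (2 ∷ 1 ∷ 6 ∷ 5 ∷ 7 ∷ 3 ∷ 4 ∷ [])

counterplay₈ : ReverseLoses 4 (IsPerm 8) []
counterplay₈ =
  next-round-by    (1 ∷ 2 ∷ 3 ∷ 4 ∷ []) (1 ∷ 2 ∷ 3 ∷ 4 ∷ 5 ∷ 6 ∷ 7 ∷ 8 ∷ []) $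
  next-round-by    (1 ∷ 2 ∷ 4 ∷ 3 ∷ []) (2 ∷ 1 ∷ 5 ∷ 4 ∷ 3 ∷ 8 ∷ 7 ∷ 6 ∷ []) $
  next-round-by    (2 ∷ 4 ∷ 1 ∷ 3 ∷ []) (3 ∷ 2 ∷ 7 ∷ 1 ∷ 6 ∷ 8 ∷ 4 ∷ 5 ∷ []) $
  reply-illegal-by (2 ∷ 1 ∷ 3 ∷ 4 ∷ []) (3 ∷ 2 ∷ 1 ∷ 7 ∷ 6 ∷ 8 ∷ 4 ∷ 5 ∷ [])

counterplay₉ : ReverseLoses 4 (IsPerm 9) []
counterplay₉ =
  next-round-by    (1 ∷ 2 ∷ 3 ∷ 4 ∷ []) (1 ∷ 2 ∷ 3 ∷ 4 ∷ 5 ∷ 6 ∷ 7 ∷ 8 ∷ 9 ∷ []) $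
  next-round-by    (1 ∷ 3 ∷ 2 ∷ 4 ∷ []) (3 ∷ 2 ∷ 1 ∷ 6 ∷ 5 ∷ 4 ∷ 9 ∷ 8 ∷ 7 ∷ []) $
  reply-illegal-by (2 ∷ 1 ∷ 4 ∷ 3 ∷ []) (4 ∷ 3 ∷ 8 ∷ 9 ∷ 5 ∷ 1 ∷ 2 ∷ 7 ∷ 6 ∷ [])

reverse-strategy-loses : ∀ n → 5 ≤ n → n ≤ 9 → ¬ ReverseStrategyWinning 4 n
reverse-strategy-loses 5 _ _ = ReverseLoses⇒¬ReverseWins counterplay₅
reverse-strategy-loses 6 _ _ = ReverseLoses⇒¬ReverseWins counterplay₆
reverse-strategy-loses 7 _ _ = ReverseLoses⇒¬ReverseWins counterplay₇
reverse-strategy-loses 8 _ _ = ReverseLoses⇒¬ReverseWins counterplay₈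
reverse-strategy-loses 9 _ _ = ReverseLoses⇒¬ReverseWins counterplay₉
reverse-strategy-loses 1 (s≤s ()) _
reverse-strategy-loses 2 (s≤s (s≤s ())) _
reverse-strategy-loses 3 (s≤s (s≤s (s≤s ()))) _
reverse-strategy-loses 4 (s≤s (s≤s (s≤s (s≤s ())))) _
reverse-strategy-loses (suc (suc (suc (suc (suc (suc (suc (suc (suc (suc _)))))))))) _
  (s≤s (s≤s (s≤s (s≤s (s≤s (s≤s (s≤s (s≤s (s≤s ())))))))))

proposition2p7 : ReverseStrategyWinning 4 4
                 × (∀ (n : ℕ) → 5 ≤ n → n ≤ 9 → ¬ ReverseStrategyWinning 4 n)
proposition2p7 = reverse-strategy-wins-S₄ , reverse-strategy-loses
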